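{- Let $n\ge 2$ and let $D_n=\langle a,b\mid a^n=e,\ b^2=e,\ bab^{ -1}=a^{ -1}\rangle$. The intersection hypergraph $\tilde{\Gamma}_\mathcal{H}(D_n)$ is a hypertree if and only if $n$ is prime or $n=4$.
   Context: For a group $G$, let $S$ be the set of all non-trivial proper subgroups of $G$. The intersection hypergraph $\tilde{\Gamma}_\mathcal{H}(G)$ has vertex set $V=\{H\in S \mid H\cap K=\{e\}\text{ for some }K\in S\}$, and a subset $E\subseteq V$ is a hyperedge iff any two distinct members of $E$ intersect trivially and $E$ is maximal among subsets of $V$ with this property. A hypergraph with vertex set $X$ is a hypertree if there exists a tree $T$ with vertex set $X$ such that every hyperedge induces a connected subgraph (a subtree) of $T$. -}

module Defs where

open import Level using (0ℓ)
open import Data.Nat using (ℕ; zero; suc; _+_; _∸_; _<_; _≤_; NonZero)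
open import Data.Nat.DivMod using (_%_; m%n<n)
open import Data.Fin using (Fin; toℕ; fromℕ<; splitAt; join)
open import Data.Fin.Subset using (Subset; _∈_; _∉_)
open import Data.Sum using (_⊎_; inj₁; inj₂)
open import Data.Product using (Σ; ∃; ∃-syntax; _×_; _,_)
open import Data.List using (List; []; _∷_; [_]; _++_; length)
open import Data.List.Relation.Unary.Unique.Propositional using (Unique)
open import Relation.Binary.PropositionalEquality using (_≡_; _≢_)
open import Relation.Nullary using (¬_)
open import Relation.Unary using (Pred; _⊆_)

record FinGroup : Set where
  field
    order : ℕ
    _·_   : Fin order → Fin order → Fin order
    inv   : Fin order → Fin order
    e     : Fin order

-- The dihedral group D_n = ⟨a,b | a^n = b^2 = e, bab⁻¹ = a⁻¹⟩ of
-- order 2n.  Element (join (inj₁ i)) is a^i, element (join (inj₂ i))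
-- is a^i b  (i ∈ {0,…,n-1}).  Exponents are taken mod n.

module _ (n : ℕ) .{{_ : NonZero n}} where

  addMod : Fin n → Fin n → Fin n
  addMod i j = fromℕ< (m%n<n (toℕ i + toℕ j) n)

  negMod : Fin n → Fin n
  negMod i = fromℕ< (m%n<n (n ∸ toℕ i) n)

  subMod : Fin n → Fin n → Fin n
  subMod i j = addMod i (negMod j)

  zeroMod : Fin n
  zeroMod = fromℕ< (m%n<n 0 n)

  -- a^i a^j = a^(i+j),  a^i (a^j b) = a^(i+j) b,
  -- (a^i b) a^j = a^(i-j) b,  (a^i b)(a^j b) = a^(i-j)
  dmul : Fin n ⊎ Fin n → Fin n ⊎ Fin n → Fin n ⊎ Fin n
  dmul (inj₁ i) (inj₁ j) = inj₁ (addMod i j)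
  dmul (inj₁ i) (inj₂ j) = inj₂ (addMod i j)
  dmul (inj₂ i) (inj₁ j) = inj₂ (subMod i j)
  dmul (inj₂ i) (inj₂ j) = inj₁ (subMod i j)

  -- (a^i)⁻¹ = a^(-i),  (a^i b)⁻¹ = a^i b
  dinv : Fin n ⊎ Fin n → Fin n ⊎ Fin n
  dinv (inj₁ i) = inj₁ (negMod i)
  dinv (inj₂ i) = inj₂ i

  Dihedral : FinGroup
  Dihedral = record
    { order = n + n
    ; _·_   = λ x y → join n n (dmul (splitAt n x) (splitAt n y))
    ; inv   = λ x → join n n (dinv (splitAt n x))
    ; e     = join n n (inj₁ zeroMod)
    }

module _ (G : FinGroup) where
  open FinGroup G

  -- subsets of G (characteristic vectors), so equality is propositional
  Sub : Set
  Sub = Subset order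

  IsSubgroup : Sub → Set
  IsSubgroup H = (e ∈ H)
               × (∀ x y → x ∈ H → y ∈ H → (x · y) ∈ H)
               × (∀ x → x ∈ H → inv x ∈ H)

  NonTrivial : Sub → Set
  NonTrivial H = ∃[ x ] (x ∈ H × x ≢ e)

  Proper : Sub → Set
  Proper H = ∃[ x ] (x ∉ H)

  InS : Pred Sub 0ℓ
  InS H = IsSubgroup H × NonTrivial H × Proper H

  TrivInt : Sub → Sub → Set
  TrivInt H K = ∀ x → x ∈ H → x ∈ K → x ≡ e

  InV : Pred Sub 0ℓ
  InV H = InS H × ∃[ K ] (InS K × TrivInt H K)

  PairwiseTriv : Pred Sub 0ℓ → Set
  PairwiseTriv E = ∀ H K → E H → E K → H ≢ K → TrivInt H K

  IsHyperedge : Pred Sub 0ℓ → Set₁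
  IsHyperedge E = (E ⊆ InV) × PairwiseTriv E
                × (∀ (F : Pred Sub 0ℓ) → F ⊆ InV → PairwiseTriv F → E ⊆ F → F ⊆ E)

module _ {A : Set} (T : A → A → Set) where

  data WalkIn (P : A → Set) : A → A → Set where
    here : ∀ {x} → P x → WalkIn P x x
    step : ∀ {x y z} → P x → T x y → WalkIn P y z → WalkIn P x z

  data Chain : List A → Set where
    nil   : Chain []
    one   : ∀ x → Chain [ x ]
    cons  : ∀ {x y xs} → T x y → Chain (y ∷ xs) → Chain (x ∷ y ∷ xs)

  Cycle : Set
  Cycle = Σ A λ x → Σ (List A) λ vs →
          (2 ≤ length vs) × Unique (x ∷ vs) × Chain (x ∷ vs ++ [ x ])

  IsTreeOn : (X : A → Set) → Set
  IsTreeOn X = (∀ x y → T x y → X x × X y)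
             × (∀ x y → T x y → T y x)
             × (∀ x → ¬ T x x)
             × (∀ x y → X x → X y → WalkIn X x y)
             × ¬ Cycle

  ConnectedIn : (E : A → Set) → Set
  ConnectedIn E = ∀ x y → E x → E y → WalkIn E x y

IntersectionHypertree : FinGroup → Set₁
IntersectionHypertree G =
  Σ (Sub G → Sub G → Set) λ T →
    IsTreeOn T (InV G) × (∀ E → IsHyperedge G E → ConnectedIn T E)

module Submission where

-- If n is prime, a nontrivial rotation generates ⟨a⟩, so every vertex other than ⟨a⟩ meets ⟨a⟩
-- trivially; ⟨a⟩ then lies in every hyperedge and the star centred at ⟨a⟩ is a host tree.  For
-- n = 4 the eight vertices and a host tree are checked by evaluation.  Otherwise n has a divisor
-- 3 ≤ m < n, which yields m + 1 pairwise intersecting hyperedges without a common vertex; this is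
-- impossible for subtrees of a tree (Helly property), because in an acyclic graph any three walks
-- forming a triangle share a vertex.

open import Defs
open import Level using (0ℓ)
open import Data.Bool using (Bool; true; false)
import Data.Bool.Properties as Bool
open import Data.Empty using (⊥; ⊥-elim)
open import Data.Fin using (Fin; zero; suc; toℕ; fromℕ<; splitAt; join; #_)
import Data.Fin.Properties as Fin
open import Data.Fin.Properties using (toℕ-fromℕ<; toℕ-injective; toℕ<n; toℕ≤n; splitAt-join; join-splitAt)
open import Data.List using (List; []; _∷_; [_]; _++_; length; map; foldl)
open import Data.List.Properties using (++-assoc; length-++)
open import Data.List.Membership.Propositional.Properties using (∈-++⁺ˡ; ∈-++⁺ʳ; ∈-++⁻; ∈-∃++; ∈-map⁺)
open import Data.List.Relation.Unary.Any using (here; there; any?)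
open import Data.List.Relation.Unary.All as All using (All; []; _∷_)
import Data.List.Relation.Unary.All.Properties as All
open import Data.List.Relation.Unary.AllPairs using ([]; _∷_)
open import Data.List.Relation.Unary.Unique.Propositional using (Unique)
import Data.List.Relation.Unary.Unique.Propositional.Properties as Unique
open import Data.List.Relation.Binary.Disjoint.Propositional using (Disjoint)
open import Data.List.Extrema.Nat using (argmax; argmax-sel; f[⊥]≤f[argmax]; f[xs]≤f[argmax])
open import Data.Nat
  using (ℕ; zero; suc; _+_; _*_; _∸_; _≤_; _<_; z≤n; s≤s; _≤?_; NonZero; ≢-nonZero; >-nonZero; >-nonZero⁻¹;
         ≢-nonZero⁻¹; n>1⇒nonTrivial; nonTrivial⇒n>1)
import Data.Nat as ℕ
open import Data.Nat.Properties
  using (≤-refl; ≤-trans; ≤-pred; <⇒≤; ≰⇒>; <-≤-trans; +-assoc; +-comm; +-suc; +-monoˡ-<; +-mono-<-≤;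
         +-mono-≤; m<m+n; m≤n+m; 1+n≰n; 1+n≢n; 1+n≢0; m+[n∸m]≡n; m∸n+n≡m; m∸[m∸n]≡n; *-identityʳ;
         *-comm; m<m*n)
open import Data.Nat.DivMod
  using (_%_; m%n<n; m<n⇒m%n≡m; %-distribˡ-+; %-remove-+ˡ; %-remove-+ʳ; %-congˡ; n%n≡0; m∣n⇒o%n%m≡o%m;
         [m+kn]%n≡m%n; %-pred-≡0; m*n%n≡0)
open import Data.Nat.Divisibility using (_∣_; divides; ∣-refl; m%n≡0⇒n∣m; n∣m⇒m%n≡0)
open import Data.Nat.Primality using (Prime; prime?; ¬prime⇒composite; composite)
open import Data.Nat.Coprimality using (prime⇒coprime; coprime-Bézout)
open import Data.Nat.GCD using (module Bézout)
open import Data.Product using (Σ; ∃; ∃₂; _×_; _,_; proj₁; proj₂)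
open import Data.Sum using (_⊎_; inj₁; inj₂; swap; fromInj₂)
open import Data.Unit using (⊤)
open import Data.Vec using (Vec; []; _∷_; tabulate; lookup)
open import Data.Vec.Properties using (≡-dec; lookup∘tabulate; []=⇒lookup; lookup⇒[]=)
open import Function using (id; _∘_)
open import Function.Bundles using (_⇔_; mk⇔)
open import Relation.Binary.Construct.Closure.ReflexiveTransitive using (Star; ε; _◅_; _◅◅_)
open import Relation.Binary.Definitions using (DecidableEquality)
open import Relation.Binary.PropositionalEquality
  using (_≡_; _≢_; refl; sym; trans; cong; cong₂; subst; subst₂; ≢-sym; module ≡-Reasoning)
open import Relation.Nullary using (¬_; Dec; yes; no; does; contradiction)
open import Relation.Nullary.Decidable
  using (_×-dec_; _⊎-dec_; _→-dec_; ¬?; decidable-stable; dec-true; from-yes; from-no)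
open import Relation.Unary using (Pred; Decidable; Satisfiable; _∩_) renaming (_⊆_ to _⊆ₚ_)

module Trees where

  open import Data.List.Membership.Propositional using (_∈_; _∉_; find; lose)
  open import Data.List.Relation.Binary.Subset.Propositional using (_⊆_)

  walkIn-snoc : ∀ {A : Set} {T : A → A → Set} {P : Pred A 0ℓ} {x y z} →
                WalkIn T P x y → T y z → P z → WalkIn T P x z
  walkIn-snoc (here Px) t Pz = step Px t (here Pz)
  walkIn-snoc (step Px t w) t′ Pz = step Px t (walkIn-snoc w t′ Pz)

  module Walks {A : Set} (_≟_ : DecidableEquality A) (T : A → A → Set) where

    open import Data.List.Membership.DecPropositional _≟_ using (_∈?_)

    vertices : ∀ {x y} → Star T x y → List A
    vertices {x} ε       = [ x ]
    vertices {x} (_ ◅ w) = x ∷ vertices w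

    vertices⁻ : ∀ {x y} → Star T x y → List A
    vertices⁻ ε           = []
    vertices⁻ {x} (_ ◅ w) = x ∷ vertices⁻ w

    steps : ∀ {x y} → Star T x y → ℕ
    steps ε       = 0
    steps (_ ◅ w) = suc (steps w)

    length-vertices⁻ : ∀ {x y} (w : Star T x y) → length (vertices⁻ w) ≡ steps w
    length-vertices⁻ ε       = refl
    length-vertices⁻ (_ ◅ w) = cong suc (length-vertices⁻ w)

    Along : Pred A 0ℓ → ∀ {x y} → Star T x y → Set
    Along P w = ∀ {u} → u ∈ vertices w → P u

    source∈ : ∀ {x y} (w : Star T x y) → x ∈ vertices w
    source∈ ε       = here refl
    source∈ (_ ◅ _) = here refl

    target∈ : ∀ {x y} (w : Star T x y) → y ∈ vertices w
    target∈ ε       = here refl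
    target∈ (_ ◅ w) = there (target∈ w)

    vertices≡vertices⁻∷ʳ : ∀ {x y} (w : Star T x y) → vertices w ≡ vertices⁻ w ++ [ y ]
    vertices≡vertices⁻∷ʳ ε           = refl
    vertices≡vertices⁻∷ʳ {x} (_ ◅ w) = cong (x ∷_) (vertices≡vertices⁻∷ʳ w)

    vertices⁻⊆vertices : ∀ {x y} (w : Star T x y) → vertices⁻ w ⊆ vertices w
    vertices⁻⊆vertices w u∈ = subst (_ ∈_) (sym (vertices≡vertices⁻∷ʳ w)) (∈-++⁺ˡ u∈)

    vertices⁻-◅◅ : ∀ {x y z} (p : Star T x y) (q : Star T y z) →
                   vertices⁻ (p ◅◅ q) ≡ vertices⁻ p ++ vertices⁻ q
    vertices⁻-◅◅ ε           q = refl
    vertices⁻-◅◅ {x} (_ ◅ p) q = cong (x ∷_) (vertices⁻-◅◅ p q)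

    steps-◅◅ : ∀ {x y z} (p : Star T x y) (q : Star T y z) → steps (p ◅◅ q) ≡ steps p + steps q
    steps-◅◅ ε       q = refl
    steps-◅◅ (_ ◅ p) q = cong suc (steps-◅◅ p q)

    ⊆-◅◅ˡ : ∀ {x y z} (p : Star T x y) (q : Star T y z) → vertices p ⊆ vertices (p ◅◅ q)
    ⊆-◅◅ˡ ε       q (here refl) = source∈ q
    ⊆-◅◅ˡ (_ ◅ p) q (here refl) = here refl
    ⊆-◅◅ˡ (_ ◅ p) q (there u∈)  = there (⊆-◅◅ˡ p q u∈)

    ⊆-◅◅ʳ : ∀ {x y z} (p : Star T x y) (q : Star T y z) → vertices q ⊆ vertices (p ◅◅ q)
    ⊆-◅◅ʳ ε       q u∈ = u∈
    ⊆-◅◅ʳ (_ ◅ p) q u∈ = there (⊆-◅◅ʳ p q u∈)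

    split : ∀ {x y v} (w : Star T x y) → v ∈ vertices w →
            Σ (Star T x v) λ p → Σ (Star T v y) λ q → w ≡ p ◅◅ q
    split ε       (here refl) = ε , ε , refl
    split (t ◅ w) (here refl) = ε , t ◅ w , refl
    split (t ◅ w) (there v∈) with p , q , refl ← split w v∈ = t ◅ p , q , refl

    steps-pos : ∀ {x y} → x ≢ y → (w : Star T x y) → 0 < steps w
    steps-pos x≢y ε       = contradiction refl x≢y
    steps-pos x≢y (_ ◅ _) = s≤s z≤n

    chain : ∀ {x y} (w : Star T x y) → Chain T (vertices w)
    chain ε             = one _
    chain (t ◅ ε)       = cons t (one _)
    chain (t ◅ t′ ◅ w) = cons t (chain (t′ ◅ w))

    Simple : ∀ {x y} → Star T x y → Set
    Simple ε           = ⊤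
    Simple {x} (_ ◅ w) = x ∉ vertices w × Simple w

    simple-◅◅ : ∀ {x y z} (p : Star T x y) (q : Star T y z) → Simple (p ◅◅ q) → Simple p × Simple q
    simple-◅◅ ε       q s = _ , s
    simple-◅◅ (_ ◅ p) q (x∉ , s) =
      let sp , sq = simple-◅◅ p q s in (x∉ ∘ ⊆-◅◅ˡ p q , sp) , sq

    simplify : ∀ {x y} (w : Star T x y) → Σ (Star T x y) λ w′ → Simple w′ × vertices w′ ⊆ vertices w
    simplify ε = ε , _ , id
    simplify {x} (t ◅ w) with w′ , s , w′⊆w ← simplify w with x ∈? vertices w′
    ... | no x∉w′ = t ◅ w′ , (x∉w′ , s) , λ { (here refl) → here refl ; (there u∈) → there (w′⊆w u∈) }
    ... | yes x∈w′ with p , q , refl ← split w′ x∈w′ =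
      q , proj₂ (simple-◅◅ p q s) , there ∘ w′⊆w ∘ ⊆-◅◅ʳ p q

    OnlyAt : A → List A → List A → Set
    OnlyAt b xs ys = ∀ {v} → v ∈ xs → v ∈ ys → v ≡ b

    record Shortcut {a b c} (p : Star T a b) (q : Star T b c) : Set where
      field
        {via}     : A
        p′        : Star T a via
        q′        : Star T via c
        shorter   : steps p′ + steps q′ < steps p + steps q
        p′⊆p      : vertices p′ ⊆ vertices p
        q′⊆q      : vertices q′ ⊆ vertices q
        p′-simple : Simple p′
        q′-simple : Simple q′

    shortcut-or-only : ∀ {a b c} (p : Star T a b) (q : Star T b c) → Simple p → Simple q →
                       Shortcut p q ⊎ OnlyAt b (vertices p) (vertices q)
    shortcut-or-only {b = b} p q sp sq with any? (λ v → v ∈? vertices q ×-dec ¬? (v ≟ b)) (vertices p)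
    ... | no none = inj₂ λ v∈p v∈q → decidable-stable (_ ≟ b) λ v≢b → none (lose v∈p (v∈q , v≢b))
    ... | yes some with v , v∈p , v∈q , v≢b ← find some
                   with p₁ , p₂ , refl ← split p v∈p
                   with q₁ , q₂ , refl ← split q v∈q = inj₁ record
      { p′        = p₁
      ; q′        = q₂
      ; shorter   = subst₂ _<_ refl (sym (cong₂ _+_ (steps-◅◅ p₁ p₂) (steps-◅◅ q₁ q₂)))
                      (+-mono-<-≤ (m<m+n (steps p₁) (steps-pos v≢b p₂)) (m≤n+m (steps q₂) (steps q₁)))
      ; p′⊆p      = ⊆-◅◅ˡ p₁ p₂
      ; q′⊆q      = ⊆-◅◅ʳ q₁ q₂
      ; p′-simple = proj₁ (simple-◅◅ p₁ p₂ sp)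
      ; q′-simple = proj₂ (simple-◅◅ q₁ q₂ sq)
      }

    simple-unique : ∀ {x y} (w : Star T x y) → Simple w → Unique (vertices⁻ w)
    simple-unique ε       _        = []
    simple-unique (_ ◅ w) (x∉ , s) =
      All.tabulate (λ u∈ x≡u → x∉ (subst (_∈ vertices w) (sym x≡u) (vertices⁻⊆vertices w u∈)))
      ∷ simple-unique w s

    target∉vertices⁻ : ∀ {x y} (w : Star T x y) → Simple w → y ∉ vertices⁻ w
    target∉vertices⁻ (_ ◅ w) (x∉ , _) (here refl) = x∉ (target∈ w)
    target∉vertices⁻ (_ ◅ w) (_ , s)  (there y∈)  = target∉vertices⁻ w s y∈

    fromWalkIn : ∀ {P x y} → WalkIn T P x y → Σ (Star T x y) (Along P)
    fromWalkIn (here Px) = ε , λ { (here refl) → Px }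
    fromWalkIn (step Px t w) with w′ , along ← fromWalkIn w =
      t ◅ w′ , λ { (here refl) → Px ; (there u∈) → along u∈ }

  module Helly {A : Set} (_≟_ : DecidableEquality A) (T : A → A → Set) (acyclic : ¬ Cycle T) where

    open Walks _≟_ T

    closed-walk-cycle : ∀ {x} (w : Star T x x) → 3 ≤ steps w → Unique (vertices⁻ w) → Cycle T
    closed-walk-cycle {x} (t ◅ w) (s≤s 2≤) unique =
      x , vertices⁻ w , subst (2 ≤_) (sym (length-vertices⁻ w)) 2≤ , unique
        , subst (Chain T ∘ (x ∷_)) (vertices≡vertices⁻∷ʳ w) (chain (t ◅ w))

    triangle-cycle : ∀ {a b c} (p : Star T a b) (q : Star T b c) (r : Star T c a) →
                     0 < steps p → 0 < steps q → 0 < steps r → Simple p → Simple q → Simple r →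
                     OnlyAt b (vertices p) (vertices q) → OnlyAt c (vertices q) (vertices r) →
                     OnlyAt a (vertices r) (vertices p) → Cycle T
    triangle-cycle p q r p>0 q>0 r>0 sp sq sr pq qr rp =
      closed-walk-cycle (p ◅◅ q ◅◅ r) three≤ (subst Unique (sym vertices⁻≡) unique)
      where
      vertices⁻≡ : vertices⁻ (p ◅◅ q ◅◅ r) ≡ vertices⁻ p ++ vertices⁻ q ++ vertices⁻ r
      vertices⁻≡ = trans (vertices⁻-◅◅ p (q ◅◅ r)) (cong (vertices⁻ p ++_) (vertices⁻-◅◅ q r))
      three≤ : 3 ≤ steps (p ◅◅ q ◅◅ r)
      three≤ = subst (3 ≤_) (sym (trans (steps-◅◅ p (q ◅◅ r)) (cong (steps p +_) (steps-◅◅ q r))))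
                     (+-mono-≤ p>0 (+-mono-≤ q>0 r>0))
      qr-disjoint : Disjoint (vertices⁻ q) (vertices⁻ r)
      qr-disjoint (v∈q , v∈r)
        with refl ← qr (vertices⁻⊆vertices q v∈q) (vertices⁻⊆vertices r v∈r) = target∉vertices⁻ q sq v∈q
      p-disjoint : Disjoint (vertices⁻ p) (vertices⁻ q ++ vertices⁻ r)
      p-disjoint (v∈p , v∈qr) with ∈-++⁻ (vertices⁻ q) v∈qr
      ... | inj₁ v∈q with refl ← pq (vertices⁻⊆vertices p v∈p) (vertices⁻⊆vertices q v∈q) =
        target∉vertices⁻ p sp v∈p
      ... | inj₂ v∈r with refl ← rp (vertices⁻⊆vertices r v∈r) (vertices⁻⊆vertices p v∈p) =
        target∉vertices⁻ r sr v∈r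
      unique : Unique (vertices⁻ p ++ vertices⁻ q ++ vertices⁻ r)
      unique = Unique.++⁺ (simple-unique p sp)
                 (Unique.++⁺ (simple-unique q sq) (simple-unique r sr) qr-disjoint) p-disjoint

    Meet₃ : List A → List A → List A → Set
    Meet₃ xs ys zs = ∃ λ v → v ∈ xs × v ∈ ys × v ∈ zs

    rotate : ∀ {xs ys zs} → Meet₃ xs ys zs → Meet₃ ys zs xs
    rotate (v , v∈xs , v∈ys , v∈zs) = v , v∈ys , v∈zs , v∈xs

    Meet₃-mono : ∀ {xs xs′ ys ys′ zs zs′} → xs ⊆ xs′ → ys ⊆ ys′ → zs ⊆ zs′ →
                 Meet₃ xs ys zs → Meet₃ xs′ ys′ zs′
    Meet₃-mono f g h (v , v∈xs , v∈ys , v∈zs) = v , f v∈xs , g v∈ys , h v∈zs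

    private
      shrink : ∀ {s′ s} z {k} → s′ < s → s + z ≤ suc k → s′ + z ≤ k
      shrink z lt bound = ≤-pred (≤-trans (+-monoˡ-< z lt) bound)

      rotate-sum : ∀ x y z → x + y + z ≡ y + z + x
      rotate-sum x y z = trans (+-assoc x y z) (+-comm x (y + z))

    -- Shortcutting two sides through a common vertex shrinks the triangle; when no side
    -- can be shortcut the triangle is a cycle.
    triangle-simple : ∀ k {a b c} (p : Star T a b) (q : Star T b c) (r : Star T c a) →
                      steps p + steps q + steps r ≤ k → Simple p → Simple q → Simple r →
                      Meet₃ (vertices p) (vertices q) (vertices r)
    triangle-simple _ ε q r _ _ _ _ = _ , here refl , source∈ q , target∈ r
    triangle-simple _ p@(_ ◅ _) ε r _ _ _ _ = _ , target∈ p , here refl , source∈ r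
    triangle-simple _ p@(_ ◅ _) q@(_ ◅ _) ε _ _ _ _ = _ , source∈ p , target∈ q , here refl
    triangle-simple zero (_ ◅ _) (_ ◅ _) (_ ◅ _) () _ _ _
    triangle-simple (suc k) p@(_ ◅ _) q@(_ ◅ _) r@(_ ◅ _) bound sp sq sr
      with shortcut-or-only p q sp sq | shortcut-or-only q r sq sr | shortcut-or-only r p sr sp
    ... | inj₁ s | _ | _ = let open Shortcut s in
      Meet₃-mono p′⊆p q′⊆q id
        (triangle-simple k p′ q′ r (shrink (steps r) shorter bound) p′-simple q′-simple sr)
    ... | inj₂ _ | inj₁ s | _ = let open Shortcut s in
      rotate (rotate (Meet₃-mono p′⊆p q′⊆q id
        (triangle-simple k p′ q′ p (shrink (steps p) shorter bound′) p′-simple q′-simple sp)))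
      where bound′ = subst (_≤ suc k) (rotate-sum (steps p) (steps q) (steps r)) bound
    ... | inj₂ _ | inj₂ _ | inj₁ s = let open Shortcut s in
      rotate (Meet₃-mono p′⊆p q′⊆q id
        (triangle-simple k p′ q′ q (shrink (steps q) shorter bound″) p′-simple q′-simple sq))
      where bound″ = subst (_≤ suc k) (trans (rotate-sum (steps p) _ _) (rotate-sum (steps q) _ _)) bound
    ... | inj₂ pq | inj₂ qr | inj₂ rp =
      ⊥-elim (acyclic (triangle-cycle p q r (s≤s z≤n) (s≤s z≤n) (s≤s z≤n) sp sq sr pq qr rp))

    triangle : ∀ {a b c} (p : Star T a b) (q : Star T b c) (r : Star T c a) →
               Meet₃ (vertices p) (vertices q) (vertices r)
    triangle p q r with p′ , sp , p′⊆p ← simplify p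
                   with q′ , sq , q′⊆q ← simplify q
                   with r′ , sr , r′⊆r ← simplify r =
      Meet₃-mono p′⊆p q′⊆q r′⊆r (triangle-simple _ p′ q′ r′ ≤-refl sp sq sr)

    walkAlong : ∀ {S : Pred A 0ℓ} {x y} → ConnectedIn T S → S x → S y → Σ (Star T x y) (Along S)
    walkAlong conn Sx Sy = fromWalkIn (conn _ _ Sx Sy)

    -- Walk along S from x to y; at each step the triangle with an S′-walk back to x shows that
    -- either the next vertex lies in S′ or x recurs later on the S-walk.
    ∩-connected : ∀ {S S′ : Pred A 0ℓ} → ConnectedIn T S → ConnectedIn T S′ → ConnectedIn T (S ∩ S′)
    ∩-connected {S} {S′} conn conn′ x y (Sx , S′x) (Sy , S′y) =
      let w , along = walkAlong conn Sx Sy in go (suc (steps w)) w ≤-refl along S′x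
      where
      go : ∀ k {x} (w : Star T x y) → steps w < k → Along S w → S′ x → WalkIn T (S ∩ S′) x y
      go _ ε _ along S′x = here (along (here refl) , S′x)
      go (suc k) (t ◅ w) (s≤s bound) along S′x
        with r , along′ ← walkAlong conn′ S′y S′x
        with triangle (t ◅ ε) w r
      ... | _ , here refl , x∈w , _ with p , q , refl ← split w x∈w =
        go k q (≤-trans (s≤s (subst (steps q ≤_) (sym (steps-◅◅ p q)) (m≤n+m (steps q) (steps p)))) bound)
           (along ∘ there ∘ ⊆-◅◅ʳ p q) S′x
      ... | _ , there (here refl) , _ , x₁∈r =
        step (along (here refl) , S′x) t (go k w bound (along ∘ there) (along′ x₁∈r))

    helly₃ : ∀ {S₁ S₂ S₃ : Pred A 0ℓ} →
             ConnectedIn T S₁ → ConnectedIn T S₂ → ConnectedIn T S₃ →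
             Satisfiable (S₁ ∩ S₂) → Satisfiable (S₂ ∩ S₃) → Satisfiable (S₃ ∩ S₁) →
             Satisfiable (S₁ ∩ S₂ ∩ S₃)
    helly₃ conn₁ conn₂ conn₃ (a , a₁ , a₂) (b , b₂ , b₃) (c , c₃ , c₁) =
      let p , along₂ = walkAlong conn₂ a₂ b₂
          q , along₃ = walkAlong conn₃ b₃ c₃
          r , along₁ = walkAlong conn₁ c₁ a₁
          v , v∈p , v∈q , v∈r = triangle p q r
      in v , along₁ v∈r , along₂ v∈p , along₃ v∈q

    -- Merge the first two subtrees into their intersection, which is again a subtree.
    helly : ∀ k (S : Fin (suc k) → Pred A 0ℓ) → (∀ i → ConnectedIn T (S i)) →
            (∀ i j → Satisfiable (S i ∩ S j)) → Satisfiable (λ x → ∀ i → S i x)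
    helly zero S _ meet with x , Sx , _ ← meet zero zero = x , λ { zero → Sx }
    helly (suc k) S conn meet =
      let x , in-merged = helly k merged merged-connected merged-meet in
      x , λ { zero          → proj₁ (in-merged zero)
            ; (suc zero)    → proj₂ (in-merged zero)
            ; (suc (suc i)) → in-merged (suc i) }
      where
      merged : Fin (suc k) → Pred A 0ℓ
      merged zero    = S zero ∩ S (suc zero)
      merged (suc i) = S (suc (suc i))

      merged-connected : ∀ i → ConnectedIn T (merged i)
      merged-connected zero    = ∩-connected (conn zero) (conn (suc zero))
      merged-connected (suc i) = conn (suc (suc i))

      meet-pair : ∀ i → Satisfiable (merged zero ∩ S (suc (suc i)))
      meet-pair i with x , S₀x , S₁x , Six ← helly₃ (conn zero) (conn (suc zero)) (conn (suc (suc i)))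
                                                 (meet _ _) (meet _ _) (meet _ _) = x , (S₀x , S₁x) , Six

      merged-meet : ∀ i j → Satisfiable (merged i ∩ merged j)
      merged-meet zero    zero    = let x , Sx = meet zero (suc zero) in x , Sx , Sx
      merged-meet zero    (suc j) = meet-pair j
      merged-meet (suc i) zero    = let x , Sx , Six = meet-pair i in x , Six , Sx
      merged-meet (suc i) (suc j) = meet (suc (suc i)) (suc (suc j))

  module RootedTree {A : Set} (_≟_ : DecidableEquality A) (X : Pred A 0ℓ)
                    (root : A) (parent : A → A) (depth : A → ℕ)
                    (parent∈X : ∀ {x} → X x → X (parent x))
                    (depth-root : depth root ≡ 0)
                    (depth-parent : ∀ {x} → X x → x ≢ root → depth x ≡ suc (depth (parent x))) where

    Up : A → A → Set
    Up x y = x ≢ root × y ≡ parent x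

    Edge : A → A → Set
    Edge x y = X x × X y × (Up x y ⊎ Up y x)

    up-edge : ∀ {x} → X x → x ≢ root → Edge x (parent x)
    up-edge Xx x≢root = Xx , parent∈X Xx , inj₁ (x≢root , refl)

    edge-sym : ∀ {x y} → Edge x y → Edge y x
    edge-sym (Xx , Xy , up) = Xy , Xx , swap up

    up-irreflexive : ∀ {x} → X x → ¬ Up x x
    up-irreflexive Xx (x≢root , x≡px) =
      1+n≢n (sym (trans (depth-parent Xx x≢root) (cong (suc ∘ depth) (sym x≡px))))

    edge-irreflexive : ∀ {x} → ¬ Edge x x
    edge-irreflexive (Xx , _ , inj₁ up) = up-irreflexive Xx up
    edge-irreflexive (Xx , _ , inj₂ up) = up-irreflexive Xx up

    edge-to-shallower : ∀ {x y} → Edge x y → depth y ≤ depth x → y ≡ parent x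
    edge-to-shallower (_ , _ , inj₁ (_ , y≡px)) _ = y≡px
    edge-to-shallower {x} (_ , Xy , inj₂ (y≢root , x≡py)) dy≤dx =
      contradiction (subst (_≤ depth x) dy≡1+dx dy≤dx) 1+n≰n
      where dy≡1+dx = trans (depth-parent Xy y≢root) (cong (suc ∘ depth) (sym x≡py))

    CycleAt : A → List A → Set
    CycleAt x vs = 2 ≤ length vs × Unique (x ∷ vs) × Chain Edge (x ∷ vs ++ [ x ])

    chain-snoc : ∀ xs {a b} → Chain Edge (xs ++ [ a ]) → Edge a b → Chain Edge (xs ++ a ∷ b ∷ [])
    chain-snoc []           (one _)    t = cons t (one _)
    chain-snoc (_ ∷ [])     (cons s c) t = cons s (chain-snoc [] c t)
    chain-snoc (_ ∷ _ ∷ xs) (cons s c) t = cons s (chain-snoc (_ ∷ xs) c t)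

    rotate : ∀ {x y} ys → CycleAt x (y ∷ ys) → CycleAt y (ys ++ [ x ])
    rotate {x} {y} ys (s≤s 1≤ , (x∉ ∷ unique) , cons x–y c) = 2≤ , unique′ , chain′
      where
      2≤ : 2 ≤ length (ys ++ [ x ])
      2≤ = subst (2 ≤_) (sym (trans (length-++ ys) (+-comm (length ys) 1))) (s≤s 1≤)
      unique′ : Unique (y ∷ ys ++ [ x ])
      unique′ = Unique.++⁺ unique ([] ∷ []) λ { (v∈ , here refl) → All.lookup x∉ v∈ refl }
      chain′ : Chain Edge (y ∷ (ys ++ [ x ]) ++ [ y ])
      chain′ = subst (Chain Edge ∘ (y ∷_)) (sym (++-assoc ys [ x ] [ y ])) (chain-snoc (y ∷ ys) c x–y)

    rotate-All : ∀ {P : Pred A 0ℓ} {x y ys} → All P (x ∷ y ∷ ys) → All P (y ∷ ys ++ [ x ])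
    rotate-All (Px ∷ Pys) = All.++⁺ Pys (Px ∷ [])

    bring-second : ∀ {P : Pred A 0ℓ} {x u} as bs → CycleAt x (as ++ u ∷ bs) → All P (x ∷ as ++ u ∷ bs) →
                   ∃₂ λ y ws → CycleAt y (u ∷ ws) × All P (y ∷ u ∷ ws)
    bring-second []       bs c all = _ , bs , c , all
    bring-second {P} {x} {u} (a ∷ as) bs c all =
      bring-second as (bs ++ [ x ]) (subst (CycleAt a) assoc (rotate (as ++ u ∷ bs) c))
                                    (subst (λ l → All P (a ∷ l)) assoc (rotate-All all))
      where assoc = ++-assoc as (u ∷ bs) [ x ]

    -- Both cycle neighbours of a deepest vertex u would have to be the parent of u.
    no-peak : ∀ {y u ws} → CycleAt y (u ∷ ws) → All (λ w → depth w ≤ depth u) (y ∷ u ∷ ws) → ⊥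
    no-peak {ws = []} (s≤s () , _) _
    no-peak {ws = _ ∷ _} (_ , (y∉ ∷ _) , cons y–u (cons u–v _)) (dy≤ ∷ _ ∷ dv≤ ∷ _) =
      All.head (All.tail y∉)
        (trans (edge-to-shallower (edge-sym y–u) dy≤) (sym (edge-to-shallower u–v dv≤)))

    peak-in-tail : ∀ {x vs u} → u ∈ vs → CycleAt x vs → All (λ w → depth w ≤ depth u) (x ∷ vs) → ⊥
    peak-in-tail u∈vs c bounded
      with as , bs , refl ← ∈-∃++ u∈vs
      with _ , _ , c′ , bounded′ ← bring-second as bs c bounded = no-peak c′ bounded′

    deepest-bound : ∀ x vs → All (λ w → depth w ≤ depth (argmax depth x vs)) (x ∷ vs)
    deepest-bound x vs = f[⊥]≤f[argmax] {f = depth} x vs ∷ f[xs]≤f[argmax] {f = depth} x vs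

    acyclic : ¬ Cycle Edge
    acyclic (x , vs , c) with argmax-sel depth x vs
    ... | inj₂ u∈vs = peak-in-tail u∈vs c (deepest-bound x vs)
    acyclic (x , [] , () , _) | inj₁ _
    acyclic (x , y ∷ ys , c) | inj₁ u≡x =
      peak-in-tail (∈-++⁺ʳ ys (here u≡x)) (rotate ys c) (rotate-All (deepest-bound x (y ∷ ys)))

    not-root : ∀ {u v} → X u → X v → u ≢ v → depth v ≤ depth u → u ≢ root
    not-root Xu Xv u≢v dv≤du refl = u≢v (sym (decidable-stable (_ ≟ root) λ v≢root →
      contradiction (subst₂ _≤_ (depth-parent Xv v≢root) depth-root dv≤du) λ ()))

    -- The parent of the deeper of two distinct vertices lies on the tree path between them.
    connected : ∀ {E : Pred A 0ℓ} → E ⊆ₚ X →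
                (∀ {u v} → E u → E v → u ≢ v → depth v ≤ depth u → E (parent u)) → ConnectedIn Edge E
    connected {E} E⊆X climb x y Ex Ey = go (suc (depth x + depth y)) Ex Ey ≤-refl
      where
      go : ∀ k {u v} → E u → E v → depth u + depth v < k → WalkIn Edge E u v
      go (suc k) {u} {v} Eu Ev (s≤s bound) with u ≟ v | depth v ≤? depth u
      ... | yes refl | _ = here Eu
      ... | no u≢v | yes dv≤du =
        let u≢root = not-root (E⊆X Eu) (E⊆X Ev) u≢v dv≤du in
        step Eu (up-edge (E⊆X Eu) u≢root)
          (go k (climb Eu Ev u≢v dv≤du) Ev
             (subst (λ d → d + depth v ≤ k) (depth-parent (E⊆X Eu) u≢root) bound))
      ... | no u≢v | no dv≰du =
        let du≤dv = <⇒≤ (≰⇒> dv≰du)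
            v≢root = not-root (E⊆X Ev) (E⊆X Eu) (≢-sym u≢v) du≤dv in
        walkIn-snoc
          (go k Eu (climb Ev Eu (≢-sym u≢v) du≤dv)
             (subst (_≤ k) (trans (cong (depth u +_) (depth-parent (E⊆X Ev) v≢root)) (+-suc (depth u) _))
                    bound))
          (edge-sym (up-edge (E⊆X Ev) v≢root)) Ev

    isTree : IsTreeOn Edge X
    isTree = (λ _ _ (Xx , Xy , _) → Xx , Xy) , (λ _ _ → edge-sym) , (λ _ → edge-irreflexive)
           , connected id (λ Xu _ _ _ → parent∈X Xu) , acyclic

open Trees

open import Data.Fin.Subset using (Subset; inside; outside; _∈_; _∉_; _⊆_)
open import Data.Fin.Subset.Properties using (_∈?_; ⊆-antisym; anySubset?)
import Data.List.Membership.Propositional as List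

subsets : ∀ N → List (Subset N)
subsets zero    = [ [] ]
subsets (suc N) = map (inside ∷_) (subsets N) ++ map (outside ∷_) (subsets N)

∈-subsets : ∀ {N} (X : Subset N) → X List.∈ subsets N
∈-subsets []            = here refl
∈-subsets (inside ∷ X)  = ∈-++⁺ˡ (∈-map⁺ (inside ∷_) (∈-subsets X))
∈-subsets (outside ∷ X) = ∈-++⁺ʳ _ (∈-map⁺ (outside ∷_) (∈-subsets X))

module Hypergraph (G : FinGroup) where

  open FinGroup G

  _≟ₛ_ : DecidableEquality (Sub G)
  _≟ₛ_ = ≡-dec Bool._≟_

  hyperedge-pairwise : ∀ {E} → IsHyperedge G E → PairwiseTriv G E
  hyperedge-pairwise = proj₁ ∘ proj₂

  TrivInt-sym : ∀ {H K} → TrivInt G H K → TrivInt G K H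
  TrivInt-sym triv x x∈K x∈H = triv x x∈H x∈K

  Compatible : Sub G → Sub G → Set
  Compatible H K = H ≡ K ⊎ TrivInt G H K

  hyperedge-compatible : ∀ {E} → IsHyperedge G E → ∀ {H K} → E H → E K → Compatible H K
  hyperedge-compatible (_ , pairwise , _) {H} {K} EH EK with H ≟ₛ K
  ... | yes H≡K = inj₁ H≡K
  ... | no  H≢K = inj₂ (pairwise H K EH EK H≢K)

  hyperedge-absorbs : ∀ {E H} → IsHyperedge G E → InV G H → (∀ K → E K → K ≢ H → TrivInt G K H) → E H
  hyperedge-absorbs {E} {H} (E⊆V , pairwise , maximal) H∈V triv = maximal F F⊆V F-pairwise inj₁ (inj₂ refl)
    where
    F : Pred (Sub G) 0ℓ
    F K = E K ⊎ K ≡ H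
    F⊆V : F ⊆ₚ InV G
    F⊆V (inj₁ EK)   = E⊆V EK
    F⊆V (inj₂ refl) = H∈V
    F-pairwise : PairwiseTriv G F
    F-pairwise K L (inj₁ EK)   (inj₁ EL)   K≢L = pairwise K L EK EL K≢L
    F-pairwise K L (inj₁ EK)   (inj₂ refl) K≢L = triv K EK K≢L
    F-pairwise K L (inj₂ refl) (inj₁ EL)   K≢L = TrivInt-sym (triv L EL (≢-sym K≢L))
    F-pairwise K L (inj₂ refl) (inj₂ refl) K≢L = contradiction refl K≢L

  Admissible : Pred (Sub G) 0ℓ → Sub G → Set
  Admissible F X = InV G X × (∀ Z → F Z → Z ≢ X → TrivInt G Z X)

  _⊕_ : Pred (Sub G) 0ℓ → Sub G → Pred (Sub G) 0ℓ
  (F ⊕ X) Y = F Y ⊎ (Y ≡ X × Admissible F X)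

  greedy : Pred (Sub G) 0ℓ → List (Sub G) → Pred (Sub G) 0ℓ
  greedy = foldl _⊕_

  greedy-⊇ : ∀ F xs → F ⊆ₚ greedy F xs
  greedy-⊇ F []       FY = FY
  greedy-⊇ F (X ∷ xs) FY = greedy-⊇ (F ⊕ X) xs (inj₁ FY)

  ⊕-pairwise : ∀ {F X} → PairwiseTriv G F → PairwiseTriv G (F ⊕ X)
  ⊕-pairwise pw Y Z (inj₁ FY)              (inj₁ FZ)              Y≢Z = pw Y Z FY FZ Y≢Z
  ⊕-pairwise pw Y Z (inj₁ FY)              (inj₂ (refl , _ , ok)) Y≢Z = ok Y FY Y≢Z
  ⊕-pairwise pw Y Z (inj₂ (refl , _ , ok)) (inj₁ FZ)              Y≢Z = TrivInt-sym (ok Z FZ (≢-sym Y≢Z))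
  ⊕-pairwise pw Y Z (inj₂ (refl , _))      (inj₂ (refl , _))      Y≢Z = contradiction refl Y≢Z

  greedy-pairwise : ∀ F xs → F ⊆ₚ InV G → PairwiseTriv G F →
                    greedy F xs ⊆ₚ InV G × PairwiseTriv G (greedy F xs)
  greedy-pairwise F []       F⊆V pairwise = F⊆V , pairwise
  greedy-pairwise F (X ∷ xs) F⊆V pairwise = greedy-pairwise (F ⊕ X) xs ⊕⊆V (⊕-pairwise pairwise)
    where
    ⊕⊆V : F ⊕ X ⊆ₚ InV G
    ⊕⊆V (inj₁ FY)              = F⊆V FY
    ⊕⊆V (inj₂ (refl , X∈V , _)) = X∈V

  greedy-maximal : ∀ F xs {F′} → F′ ⊆ₚ InV G → PairwiseTriv G F′ → greedy F xs ⊆ₚ F′ →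
                   ∀ {X} → X List.∈ xs → F′ X → greedy F xs X
  greedy-maximal F (X ∷ xs) F′⊆V pairwise′ greedy⊆F′ (here refl) F′X =
    greedy-⊇ (F ⊕ X) xs (inj₂ (refl , F′⊆V F′X , λ Z FZ Z≢X →
      pairwise′ Z X (greedy⊆F′ (greedy-⊇ (F ⊕ X) xs (inj₁ FZ))) F′X Z≢X))
  greedy-maximal F (Y ∷ xs) F′⊆V pairwise′ greedy⊆F′ (there X∈xs) F′X =
    greedy-maximal (F ⊕ Y) xs F′⊆V pairwise′ greedy⊆F′ X∈xs F′X

  extend-to-hyperedge : ∀ {F} → F ⊆ₚ InV G → PairwiseTriv G F →
                        Σ (Pred (Sub G) 0ℓ) λ E → IsHyperedge G E × F ⊆ₚ E
  extend-to-hyperedge {F} F⊆V pairwise =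
    greedy F candidates , (E⊆V , E-pairwise , maximal) , greedy-⊇ F candidates
    where
    candidates = subsets order
    E⊆V        = proj₁ (greedy-pairwise F candidates F⊆V pairwise)
    E-pairwise = proj₂ (greedy-pairwise F candidates F⊆V pairwise)
    maximal : ∀ F′ → F′ ⊆ₚ InV G → PairwiseTriv G F′ → greedy F candidates ⊆ₚ F′ → F′ ⊆ₚ greedy F candidates
    maximal F′ F′⊆V pairwise′ E⊆F′ = greedy-maximal F candidates F′⊆V pairwise′ E⊆F′ (∈-subsets _)

  trivInt? : ∀ H K → Dec (TrivInt G H K)
  trivInt? H K = Fin.all? λ x → x ∈? H →-dec (x ∈? K →-dec x Fin.≟ e)

  compatible? : ∀ H K → Dec (Compatible H K)
  compatible? H K = H ≟ₛ K ⊎-dec trivInt? H K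

  isSubgroup? : ∀ H → Dec (IsSubgroup G H)
  isSubgroup? H = e ∈? H
    ×-dec (Fin.all? λ x → Fin.all? λ y → x ∈? H →-dec (y ∈? H →-dec (x · y) ∈? H))
    ×-dec (Fin.all? λ x → x ∈? H →-dec inv x ∈? H)

  inS? : ∀ H → Dec (InS G H)
  inS? H = isSubgroup? H
    ×-dec Fin.any? (λ x → x ∈? H ×-dec ¬? (x Fin.≟ e))
    ×-dec Fin.any? (λ x → ¬? (x ∈? H))

does-true⇒ : ∀ {P : Set} (P? : Dec P) → does P? ≡ true → P
does-true⇒ (yes p) _  = p
does-true⇒ (no _)  ()

module _ {m : ℕ} .{{_ : NonZero m}} where

  0%≡0 : 0 % m ≡ 0
  0%≡0 = m<n⇒m%n≡m (>-nonZero⁻¹ m)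

  %-absorbˡ : ∀ {a} b → a % m ≡ 0 → (a + b) % m ≡ b % m
  %-absorbˡ {a} b a%≡0 = %-remove-+ˡ b (m%n≡0⇒n∣m a m a%≡0)

  %-absorbʳ : ∀ a {b} → b % m ≡ 0 → (a + b) % m ≡ a % m
  %-absorbʳ a {b} b%≡0 = %-remove-+ʳ a (m%n≡0⇒n∣m b m b%≡0)

  +-%-congˡ : ∀ {a a′} b → a % m ≡ a′ % m → (a + b) % m ≡ (a′ + b) % m
  +-%-congˡ {a} {a′} b eq =
    trans (%-distribˡ-+ a b m) (trans (cong (λ r → (r + b % m) % m) eq) (sym (%-distribˡ-+ a′ b m)))

  +-%-congʳ : ∀ a {b b′} → b % m ≡ b′ % m → (a + b) % m ≡ (a + b′) % m
  +-%-congʳ a {b} {b′} eq =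
    trans (%-distribˡ-+ a b m) (trans (cong (λ r → (a % m + r) % m) eq) (sym (%-distribˡ-+ a b′ m)))

  module _ {n : ℕ} (m∣n : m ∣ n) where

    +∸-%≡0 : ∀ {k} → k ≤ n → (k + (n ∸ k)) % m ≡ 0
    +∸-%≡0 k≤n = trans (%-congˡ (m+[n∸m]≡n k≤n)) (n∣m⇒m%n≡0 n m m∣n)

    ∸-%≡0 : ∀ {k} → k ≤ n → k % m ≡ 0 → (n ∸ k) % m ≡ 0
    ∸-%≡0 {k} k≤n k%≡0 = trans (sym (%-absorbˡ (n ∸ k) k%≡0)) (+∸-%≡0 k≤n)

module DihedralGroup (n : ℕ) .{{_ : NonZero n}} (2≤n : 2 ≤ n) where

  D : FinGroup
  D = Dihedral n

  open FinGroup D using (e; _·_; inv)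
  open Hypergraph D public

  El : Set
  El = Fin n ⊎ Fin n

  element : El → Fin (n + n)
  element = join n n

  rotation reflection : Fin n → Fin (n + n)
  rotation i   = element (inj₁ i)
  reflection i = element (inj₂ i)

  rot : ℕ → Fin n
  rot t = fromℕ< (m%n<n t n)

  toℕ-rot : ∀ t → toℕ (rot t) ≡ t % n
  toℕ-rot t = toℕ-fromℕ< (m%n<n t n)

  rot-toℕ : ∀ i → rot (toℕ i) ≡ i
  rot-toℕ i = toℕ-injective (trans (toℕ-rot (toℕ i)) (m<n⇒m%n≡m (toℕ<n i)))

  rot-cong : ∀ {t s} → t % n ≡ s % n → rot t ≡ rot s
  rot-cong {t} {s} eq = toℕ-injective (trans (toℕ-rot t) (trans eq (sym (toℕ-rot s))))

  toℕ-rot-1 : toℕ (rot 1) ≡ 1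
  toℕ-rot-1 = trans (toℕ-rot 1) (m<n⇒m%n≡m 2≤n)

  module _ {m : ℕ} .{{_ : NonZero m}} (m∣n : m ∣ n) where

    rot-% : ∀ t → toℕ (rot t) % m ≡ t % m
    rot-% t = trans (cong (_% m) (toℕ-rot t)) (m∣n⇒o%n%m≡o%m m n t m∣n)

    subMod-% : ∀ i k → toℕ (subMod n i k) % m ≡ (toℕ i + (n ∸ toℕ k)) % m
    subMod-% i k = trans (rot-% (toℕ i + toℕ (negMod n k))) (+-%-congʳ (toℕ i) (rot-% (n ∸ toℕ k)))

  element-· : ∀ z w → element z · element w ≡ element (dmul n z w)
  element-· z w = cong₂ (λ z w → join n n (dmul n z w)) (splitAt-join n n z) (splitAt-join n n w)

  element-inv : ∀ z → inv (element z) ≡ element (dinv n z)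
  element-inv z = cong (join n n ∘ dinv n) (splitAt-join n n z)

  element-injective : ∀ {z w} → element z ≡ element w → z ≡ w
  element-injective {z} {w} eq =
    trans (sym (splitAt-join n n z)) (trans (cong (splitAt n) eq) (splitAt-join n n w))

  ∀-element : ∀ {P : Pred (Fin (n + n)) 0ℓ} → (∀ z → P (element z)) → ∀ x → P x
  ∀-element {P} P-element x = subst P (join-splitAt n n x) (P-element (splitAt n x))

  rotation≡e⇒0 : ∀ {i} → rotation i ≡ e → toℕ i ≡ 0
  rotation≡e⇒0 {i} eq with refl ← element-injective {inj₁ i} {inj₁ (rot 0)} eq = trans (toℕ-rot 0) 0%≡0

  0⇒rotation≡e : ∀ {i} → toℕ i ≡ 0 → rotation i ≡ e
  0⇒rotation≡e i≡0 = cong rotation (toℕ-injective (trans i≡0 (sym (trans (toℕ-rot 0) 0%≡0))))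

  reflection≢e : ∀ {i} → reflection i ≢ e
  reflection≢e {i} eq with () ← element-injective {inj₂ i} {inj₁ (rot 0)} eq

  module _ {H : Sub D} (H≤D : IsSubgroup D H) where

    ·-closed : ∀ z w → element z ∈ H → element w ∈ H → element (dmul n z w) ∈ H
    ·-closed z w z∈H w∈H = subst (_∈ H) (element-· z w) (proj₁ (proj₂ H≤D) _ _ z∈H w∈H)

    inv-closed : ∀ z → element z ∈ H → element (dinv n z) ∈ H
    inv-closed z z∈H = subst (_∈ H) (element-inv z) (proj₂ (proj₂ H≤D) _ z∈H)

  ⟦_⟧ : ∀ {P : Pred El 0ℓ} → Decidable P → Sub D
  ⟦ P? ⟧ = tabulate (λ x → does (P? (splitAt n x)))

  lookup-⟦⟧ : ∀ {P : Pred El 0ℓ} (P? : Decidable P) z → lookup ⟦ P? ⟧ (element z) ≡ does (P? z)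
  lookup-⟦⟧ P? z = trans (lookup∘tabulate _ (element z)) (cong (does ∘ P?) (splitAt-join n n z))

  ∈⟦⟧⁺ : ∀ {P : Pred El 0ℓ} (P? : Decidable P) {z} → P z → element z ∈ ⟦ P? ⟧
  ∈⟦⟧⁺ P? {z} Pz = lookup⇒[]= (element z) _ (trans (lookup-⟦⟧ P? z) (dec-true (P? z) Pz))

  ∈⟦⟧⁻ : ∀ {P : Pred El 0ℓ} (P? : Decidable P) {z} → element z ∈ ⟦ P? ⟧ → P z
  ∈⟦⟧⁻ P? {z} z∈ = does-true⇒ (P? z) (trans (sym (lookup-⟦⟧ P? z)) ([]=⇒lookup z∈))

  ⟦⟧-subgroup : ∀ {P : Pred El 0ℓ} (P? : Decidable P) → P (inj₁ (rot 0)) →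
                (∀ z w → P z → P w → P (dmul n z w)) → (∀ z → P z → P (dinv n z)) →
                IsSubgroup D ⟦ P? ⟧
  ⟦⟧-subgroup {P} P? Pe P-· P-inv = ∈⟦⟧⁺ P? Pe , ∀-element ·-closed′ , ∀-element inv-closed′
    where
    ·-closed′ : ∀ z y → element z ∈ ⟦ P? ⟧ → y ∈ ⟦ P? ⟧ → element z · y ∈ ⟦ P? ⟧
    ·-closed′ z = ∀-element λ w z∈ w∈ →
      subst (_∈ ⟦ P? ⟧) (sym (element-· z w)) (∈⟦⟧⁺ P? (P-· z w (∈⟦⟧⁻ P? z∈) (∈⟦⟧⁻ P? w∈)))
    inv-closed′ : ∀ z → element z ∈ ⟦ P? ⟧ → inv (element z) ∈ ⟦ P? ⟧
    inv-closed′ z z∈ = subst (_∈ ⟦ P? ⟧) (sym (element-inv z)) (∈⟦⟧⁺ P? (P-inv z (∈⟦⟧⁻ P? z∈)))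

  IsRotation : Pred El 0ℓ
  IsRotation (inj₁ _) = ⊤
  IsRotation (inj₂ _) = ⊥

  isRotation? : Decidable IsRotation
  isRotation? (inj₁ _) = yes _
  isRotation? (inj₂ _) = no id

  A : Sub D
  A = ⟦ isRotation? ⟧

  rotation∈A : ∀ {i} → rotation i ∈ A
  rotation∈A {i} = ∈⟦⟧⁺ isRotation? {inj₁ i} _

  reflection∉A : ∀ {i} → reflection i ∉ A
  reflection∉A {i} = ∈⟦⟧⁻ isRotation? {inj₂ i}

  A-InS : InS D A
  A-InS = ⟦⟧-subgroup isRotation? _ (λ { (inj₁ _) (inj₁ _) _ _ → _ }) (λ { (inj₁ _) _ → _ })
        , (rotation (rot 1) , rotation∈A , λ eq → 1+n≢0 (trans (sym toℕ-rot-1) (rotation≡e⇒0 eq)))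
        , (reflection (rot 0) , reflection∉A)

  -- Q m j is ⟨a^m, a^j b⟩ when m ∣ n.
  module _ (m : ℕ) .{{_ : NonZero m}} (j : Fin m) where

    InQ : Pred El 0ℓ
    InQ (inj₁ i) = toℕ i % m ≡ 0
    InQ (inj₂ i) = toℕ i % m ≡ toℕ j

    inQ? : Decidable InQ
    inQ? (inj₁ i) = toℕ i % m ℕ.≟ 0
    inQ? (inj₂ i) = toℕ i % m ℕ.≟ toℕ j

    Q : Sub D
    Q = ⟦ inQ? ⟧

    Q-subgroup : m ∣ n → IsSubgroup D Q
    Q-subgroup m∣n = ⟦⟧-subgroup inQ? (trans (rot-% m∣n 0) 0%≡0) closed-· closed-inv
      where
      closed-· : ∀ z w → InQ z → InQ w → InQ (dmul n z w)
      closed-· (inj₁ i) (inj₁ k) i≡0 k≡0 = trans (rot-% m∣n _) (trans (%-absorbˡ (toℕ k) i≡0) k≡0)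
      closed-· (inj₁ i) (inj₂ k) i≡0 k≡j = trans (rot-% m∣n _) (trans (%-absorbˡ (toℕ k) i≡0) k≡j)
      closed-· (inj₂ i) (inj₁ k) i≡j k≡0 =
        trans (subMod-% m∣n i k) (trans (%-absorbʳ (toℕ i) (∸-%≡0 m∣n (toℕ≤n k) k≡0)) i≡j)
      closed-· (inj₂ i) (inj₂ k) i≡j k≡j =
        trans (subMod-% m∣n i k) (trans (+-%-congˡ _ (trans i≡j (sym k≡j))) (+∸-%≡0 m∣n (toℕ≤n k)))
      closed-inv : ∀ z → InQ z → InQ (dinv n z)
      closed-inv (inj₁ i) i≡0 = trans (rot-% m∣n _) (∸-%≡0 m∣n (toℕ≤n i) i≡0)
      closed-inv (inj₂ i) i≡j = i≡j

    Q-InS : m ∣ n → 2 ≤ m → InS D Q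
    Q-InS m∣n 2≤m =
      Q-subgroup m∣n , (reflection (rot (toℕ j)) , j∈Q , reflection≢e) , (rotation (rot 1) , a∉Q)
      where
      j∈Q : reflection (rot (toℕ j)) ∈ Q
      j∈Q = ∈⟦⟧⁺ inQ? {inj₂ (rot (toℕ j))} (trans (rot-% m∣n (toℕ j)) (m<n⇒m%n≡m (toℕ<n j)))
      a∉Q : rotation (rot 1) ∉ Q
      a∉Q a∈Q = 1+n≢0 (trans (sym (m<n⇒m%n≡m 2≤m)) (trans (sym (rot-% m∣n 1)) (∈⟦⟧⁻ inQ? {inj₁ (rot 1)} a∈Q)))

  -- R k is ⟨a^k b⟩ = {e, a^k b}.
  R : Fin n → Sub D
  R = Q n

  R-InS : ∀ k → InS D (R k)
  R-InS k = Q-InS n k ∣-refl 2≤n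

  reflection∈R : ∀ {k} → reflection k ∈ R k
  reflection∈R {k} = ∈⟦⟧⁺ (inQ? n k) {inj₂ k} (m<n⇒m%n≡m (toℕ<n k))

  rotation∈R : ∀ {i k} → rotation i ∈ R k → toℕ i ≡ 0
  rotation∈R {i} {k} i∈R = trans (sym (m<n⇒m%n≡m (toℕ<n i))) (∈⟦⟧⁻ (inQ? n k) {inj₁ i} i∈R)

  reflection∈R⇒≡ : ∀ {i k} → reflection i ∈ R k → toℕ i ≡ toℕ k
  reflection∈R⇒≡ {i} {k} i∈R = trans (sym (m<n⇒m%n≡m (toℕ<n i))) (∈⟦⟧⁻ (inQ? n k) {inj₂ i} i∈R)

  R-TrivInt : ∀ {H} k → reflection k ∉ H → TrivInt D H (R k)
  R-TrivInt {H} k k∉H = ∀-element triv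
    where
    triv : ∀ z → element z ∈ H → element z ∈ R k → element z ≡ e
    triv (inj₁ i) _   i∈R = 0⇒rotation≡e (rotation∈R i∈R)
    triv (inj₂ i) i∈H i∈R =
      contradiction (subst (λ i → reflection i ∈ H) (toℕ-injective (reflection∈R⇒≡ i∈R)) i∈H) k∉H

  R-R-TrivInt : ∀ {k k′} → R k ≢ R k′ → TrivInt D (R k) (R k′)
  R-R-TrivInt {k} {k′} R≢R = R-TrivInt k′ λ k′∈R → R≢R (cong R (sym (toℕ-injective (reflection∈R⇒≡ k′∈R))))

  A-InV : InV D A
  A-InV = A-InS , R (rot 0) , R-InS (rot 0) , R-TrivInt (rot 0) reflection∉A

  R-InV : ∀ k → InV D (R k)
  R-InV k = R-InS k , A , A-InS , TrivInt-sym (R-TrivInt k reflection∉A)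

module PrimeCase (n : ℕ) .{{_ : NonZero n}} (2≤n : 2 ≤ n) (n-prime : Prime n) where

  open DihedralGroup n 2≤n
  open FinGroup D using (e)
  open ≡-Reasoning

  module _ {H : Sub D} (H≤D : IsSubgroup D H) where

    powers∈ : ∀ {i} → rotation i ∈ H → ∀ c → rotation (rot (c * toℕ i)) ∈ H
    powers∈ i∈H zero    = proj₁ H≤D
    powers∈ {i} i∈H (suc c) =
      subst (λ k → rotation k ∈ H) (rot-cong eq) (·-closed H≤D (inj₁ _) (inj₁ i) (powers∈ i∈H c) i∈H)
      where
      eq : (toℕ (rot (c * toℕ i)) + toℕ i) % n ≡ (toℕ i + c * toℕ i) % n
      eq = begin
        (toℕ (rot (c * toℕ i)) + toℕ i) % n ≡⟨ +-%-congˡ (toℕ i) (rot-% ∣-refl (c * toℕ i)) ⟩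
        (c * toℕ i + toℕ i) % n             ≡⟨ cong (_% n) (+-comm (c * toℕ i) (toℕ i)) ⟩
        (toℕ i + c * toℕ i) % n             ∎

    -- Bézout: some multiple of a nonzero exponent i is ±1 mod the prime n.
    generator∈ : ∀ {i} → rotation i ∈ H → toℕ i ≢ 0 → rotation (rot 1) ∈ H
    generator∈ {i} i∈H i≢0 with coprime-Bézout (prime⇒coprime n-prime {{≢-nonZero i≢0}} (toℕ<n i))
    ... | Bézout.-+ x y 1+xn≡yi =
      subst (λ k → rotation k ∈ H) (rot-cong (trans (cong (_% n) (sym 1+xn≡yi)) ([m+kn]%n≡m%n 1 x n)))
            (powers∈ i∈H y)
    ... | Bézout.+- x y 1+yi≡xn =
      subst (λ k → rotation k ∈ H) (cong rot n∸[yi%n]≡1) (inv-closed H≤D (inj₁ _) (powers∈ i∈H y))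
      where
      n∸[yi%n]≡1 : n ∸ toℕ (rot (y * toℕ i)) ≡ 1
      n∸[yi%n]≡1 = begin
        n ∸ toℕ (rot (y * toℕ i)) ≡⟨ cong (n ∸_) (toℕ-rot (y * toℕ i)) ⟩
        n ∸ (y * toℕ i) % n       ≡⟨ cong (n ∸_) (%-pred-≡0 (trans (cong (_% n) 1+yi≡xn) (m*n%n≡0 x n))) ⟩
        n ∸ (n ∸ 1)               ≡⟨ m∸[m∸n]≡n (≤-trans (s≤s z≤n) 2≤n) ⟩
        1                         ∎

    rotations∈ : rotation (rot 1) ∈ H → ∀ t → rotation t ∈ H
    rotations∈ a∈H t = subst (λ k → rotation k ∈ H) rot-t (powers∈ a∈H (toℕ t))
      where
      rot-t : rot (toℕ t * toℕ (rot 1)) ≡ t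
      rot-t = begin
        rot (toℕ t * toℕ (rot 1)) ≡⟨ cong (λ k → rot (toℕ t * k)) toℕ-rot-1 ⟩
        rot (toℕ t * 1)           ≡⟨ cong rot (*-identityʳ (toℕ t)) ⟩
        rot (toℕ t)               ≡⟨ rot-toℕ t ⟩
        t                         ∎

    everything∈ : (∀ t → rotation t ∈ H) → ∀ {k} → reflection k ∈ H → ∀ x → x ∈ H
    everything∈ rotations∈H {k} k∈H = ∀-element λ { (inj₁ t) → rotations∈H t ; (inj₂ t) → reflection∈ t }
      where
      -- a^t b = a^(t-k) · a^k b
      reflection∈ : ∀ t → reflection t ∈ H
      reflection∈ t = subst (λ i → reflection i ∈ H) (trans (rot-cong eq) (rot-toℕ t))
                            (·-closed H≤D (inj₁ (subMod n t k)) (inj₂ k) (rotations∈H (subMod n t k)) k∈H)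
        where
        eq : (toℕ (subMod n t k) + toℕ k) % n ≡ toℕ t % n
        eq = begin
          (toℕ (subMod n t k) + toℕ k) % n ≡⟨ +-%-congˡ (toℕ k) (subMod-% ∣-refl t k) ⟩
          (toℕ t + (n ∸ toℕ k) + toℕ k) % n ≡⟨ cong (_% n) (+-assoc (toℕ t) _ (toℕ k)) ⟩
          (toℕ t + (n ∸ toℕ k + toℕ k)) % n ≡⟨ cong (λ r → (toℕ t + r) % n) (m∸n+n≡m (toℕ≤n k)) ⟩
          (toℕ t + n) % n                   ≡⟨ %-absorbʳ (toℕ t) (n%n≡0 n) ⟩
          toℕ t % n                         ∎

  -- A nontrivial rotation in H generates all of ⟨a⟩, and then a reflection in H would make
  -- H the whole group; so H ⊆ ⟨a⟩ ⊆ H.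
  meets-A-trivially : ∀ {H} → InS D H → H ≢ A → TrivInt D H A
  meets-A-trivially {H} (H≤D , _ , y , y∉H) H≢A = ∀-element triv
    where
    H⊆A : (∀ t → rotation t ∈ H) → H ⊆ A
    H⊆A rotations∈H {x} = ∀-element {P = λ x → x ∈ H → x ∈ A}
      (λ { (inj₁ t) _   → rotation∈A
         ; (inj₂ k) k∈H → contradiction (everything∈ H≤D rotations∈H k∈H y) y∉H }) x
    A⊆H : (∀ t → rotation t ∈ H) → A ⊆ H
    A⊆H rotations∈H {x} = ∀-element {P = λ x → x ∈ A → x ∈ H}
      (λ { (inj₁ t) _   → rotations∈H t
         ; (inj₂ k) k∈A → contradiction k∈A reflection∉A }) x
    triv : ∀ z → element z ∈ H → element z ∈ A → element z ≡ e
    triv (inj₂ k) _ k∈A = contradiction k∈A reflection∉A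
    triv (inj₁ i) i∈H _ = 0⇒rotation≡e (decidable-stable (toℕ i ℕ.≟ 0) λ i≢0 →
      let rotations∈H = rotations∈ H≤D (generator∈ H≤D i∈H i≢0) in
      H≢A (⊆-antisym (H⊆A rotations∈H) (A⊆H rotations∈H)))

  A∈hyperedge : ∀ {E} → IsHyperedge D E → E A
  A∈hyperedge hyp@(E⊆V , _) =
    hyperedge-absorbs hyp A-InV λ K EK K≢A → meets-A-trivially (proj₁ (E⊆V EK)) K≢A

  depth : Sub D → ℕ
  depth H with H ≟ₛ A
  ... | yes _ = 0
  ... | no  _ = 1

  depth-A : depth A ≡ 0
  depth-A with A ≟ₛ A
  ... | yes _   = refl
  ... | no  A≢A = contradiction refl A≢A

  depth-below-A : ∀ {H} → InV D H → H ≢ A → depth H ≡ suc (depth A)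
  depth-below-A {H} _ H≢A with H ≟ₛ A
  ... | yes H≡A = contradiction H≡A H≢A
  ... | no  _   = cong suc (sym depth-A)

  open RootedTree _≟ₛ_ (InV D) A (λ _ → A) depth (λ _ → A-InV) depth-A depth-below-A

  hypertree : IntersectionHypertree D
  hypertree = Edge , isTree , λ E hyp → connected (proj₁ hyp) (λ _ _ _ _ → A∈hyperedge hyp)

avoid-0-and : ∀ b → ∃ λ t → t < 3 × t ≢ 0 × t ≢ b
avoid-0-and b with 1 ℕ.≟ b
... | no 1≢b   = 1 , s≤s (s≤s z≤n) , (λ ()) , 1≢b
... | yes refl = 2 , ≤-refl , (λ ()) , λ ()

avoid-two : ∀ a b → ∃ λ t → t < 3 × t ≢ a × t ≢ b
avoid-two a b with 0 ℕ.≟ a | 0 ℕ.≟ b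
... | no 0≢a   | no 0≢b   = 0 , s≤s z≤n , 0≢a , 0≢b
... | yes refl | _        = avoid-0-and b
... | no _     | yes refl = let t , t<3 , t≢0 , t≢a = avoid-0-and a in t , t<3 , t≢a , t≢0

-- A proper divisor 3 ≤ m of n yields hyperedges E⋆ ⊇ {⟨a⟩} ∪ {⟨a^k b⟩} and, for each j < m,
-- E_j ⊇ {⟨a^m, a^j b⟩} ∪ {⟨a^k b⟩ : k ≢ j mod m}.  They pairwise share some ⟨a^t b⟩ with t < 3,
-- but a common vertex would be ⟨a⟩ (which meets ⟨a^m, b⟩ in a^m) or some ⟨a^i b⟩ (which meets
-- ⟨a^m, a^i b⟩ in a^i b); so by the Helly property no host tree exists.
module CompositeCase (n : ℕ) .{{_ : NonZero n}} (2≤n : 2 ≤ n)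
                     (m : ℕ) (m∣n : m ∣ n) (3≤m : 3 ≤ m) (m<n : m < n) where

  open DihedralGroup n 2≤n
  open FinGroup D using (e)

  instance
    m-nonZero : NonZero m
    m-nonZero = >-nonZero (≤-trans (s≤s z≤n) 3≤m)

  rot-m∈Q : ∀ j → rotation (rot m) ∈ Q m j
  rot-m∈Q j = ∈⟦⟧⁺ (inQ? m j) {inj₁ (rot m)} (trans (rot-% m∣n m) (n%n≡0 m))

  rot-m≢e : rotation (rot m) ≢ e
  rot-m≢e eq = ≢-nonZero⁻¹ m (trans (sym (m<n⇒m%n≡m m<n)) (trans (sym (toℕ-rot m)) (rotation≡e⇒0 eq)))

  2≤m : 2 ≤ m
  2≤m = ≤-trans (s≤s (s≤s z≤n)) 3≤m

  A≢Q : ∀ j → A ≢ Q m j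
  A≢Q j A≡Q = proj₂ (proj₂ (proj₂ (Q-InS m j m∣n 2≤m))) (subst (rotation (rot 1) ∈_) A≡Q rotation∈A)

  R≢Q : ∀ k j → R k ≢ Q m j
  R≢Q k j R≡Q = rot-m≢e (0⇒rotation≡e (rotation∈R (subst (rotation (rot m) ∈_) (sym R≡Q) (rot-m∈Q j))))

  hub : Fin (suc m) → Sub D
  hub zero    = A
  hub (suc j) = Q m j

  -- residue zero is a dummy value: ⟨a⟩ contains no reflection.
  residue : Fin (suc m) → ℕ
  residue zero    = 0
  residue (suc j) = toℕ j

  reflection∉hub : ∀ i {t} → t < 3 → t ≢ residue i → reflection (rot t) ∉ hub i
  reflection∉hub zero    _   _   = reflection∉A
  reflection∉hub (suc j) {t} t<3 t≢j t∈Q = t≢j (trans (sym t%m≡t) (∈⟦⟧⁻ (inQ? m j) {inj₂ (rot t)} t∈Q))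
    where t%m≡t = trans (rot-% m∣n t) (m<n⇒m%n≡m (<-≤-trans t<3 3≤m))

  hub-InV : ∀ i → InV D (hub i)
  hub-InV zero    = A-InV
  hub-InV (suc j) =
    let t , t<3 , t≢j , _ = avoid-two (toℕ j) (toℕ j) in
    Q-InS m j m∣n 2≤m , R (rot t) , R-InS (rot t) , R-TrivInt (rot t) (reflection∉hub (suc j) t<3 t≢j)

  Seed : Sub D → Pred (Sub D) 0ℓ
  Seed X H = H ≡ X ⊎ ∃ λ k → reflection k ∉ X × H ≡ R k

  Seed⊆V : ∀ {X} → InV D X → Seed X ⊆ₚ InV D
  Seed⊆V X∈V (inj₁ refl)           = X∈V
  Seed⊆V X∈V (inj₂ (k , _ , refl)) = R-InV k

  Seed-pairwise : ∀ X → PairwiseTriv D (Seed X)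
  Seed-pairwise X H K (inj₁ refl)            (inj₁ refl)            H≢K = contradiction refl H≢K
  Seed-pairwise X H K (inj₁ refl)            (inj₂ (k , k∉X , refl)) _  = R-TrivInt k k∉X
  Seed-pairwise X H K (inj₂ (k , k∉X , refl)) (inj₁ refl)            _  = TrivInt-sym (R-TrivInt k k∉X)
  Seed-pairwise X H K (inj₂ (_ , _ , refl))   (inj₂ (_ , _ , refl))  H≢K = R-R-TrivInt H≢K

  extension : ∀ i → Σ (Pred (Sub D) 0ℓ) λ E → IsHyperedge D E × Seed (hub i) ⊆ₚ E
  extension i = extend-to-hyperedge (Seed⊆V (hub-InV i)) (Seed-pairwise (hub i))

  family : Fin (suc m) → Pred (Sub D) 0ℓ
  family i = proj₁ (extension i)

  family-hyperedge : ∀ i → IsHyperedge D (family i)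
  family-hyperedge i = proj₁ (proj₂ (extension i))

  seed⊆family : ∀ i → Seed (hub i) ⊆ₚ family i
  seed⊆family i = proj₂ (proj₂ (extension i))

  family-meet : ∀ i j → Satisfiable (family i ∩ family j)
  family-meet i j =
    let t , t<3 , t≢i , t≢j = avoid-two (residue i) (residue j) in
    R (rot t) , seed⊆family i (inj₂ (rot t , reflection∉hub i t<3 t≢i , refl))
              , seed⊆family j (inj₂ (rot t , reflection∉hub j t<3 t≢j , refl))

  no-common : ¬ Satisfiable (λ X → ∀ i → family i X)
  no-common (X , X∈) with X ≟ₛ A
  ... | yes refl =
    rot-m≢e (hyperedge-pairwise (family-hyperedge (suc j₀)) A (Q m j₀) (X∈ (suc j₀))
               (seed⊆family (suc j₀) (inj₁ refl)) (A≢Q j₀) _ rotation∈A (rot-m∈Q j₀))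
    where j₀ = fromℕ< (>-nonZero⁻¹ m)
  ... | no X≢A = ∀-element {P = λ x → x ∈ X → x ≢ e → ⊥} clash x x∈X x≢e
    where
    pairwise⋆ = hyperedge-pairwise (family-hyperedge zero)
    X∈E⋆ = X∈ zero
    nontrivial = proj₁ (proj₂ (proj₁ (proj₁ (family-hyperedge zero) X∈E⋆)))
    x = proj₁ nontrivial
    x∈X = proj₁ (proj₂ nontrivial)
    x≢e = proj₂ (proj₂ nontrivial)
    clash : ∀ z → element z ∈ X → element z ≢ e → ⊥
    clash (inj₁ i) i∈X i≢e = i≢e (pairwise⋆ X A X∈E⋆ (seed⊆family zero (inj₁ refl)) X≢A _ i∈X rotation∈A)
    clash (inj₂ i) i∈X i≢e with X ≟ₛ R i
    ... | no X≢R =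
      i≢e (pairwise⋆ X (R i) X∈E⋆ (seed⊆family zero (inj₂ (i , reflection∉A , refl))) X≢R _ i∈X reflection∈R)
    ... | yes refl = i≢e (hyperedge-pairwise (family-hyperedge (suc j)) (R i) (Q m j) (X∈ (suc j))
                           (seed⊆family (suc j) (inj₁ refl)) (R≢Q i j) _ reflection∈R i∈Q)
      where
      j = fromℕ< (m%n<n (toℕ i) m)
      i∈Q : reflection i ∈ Q m j
      i∈Q = ∈⟦⟧⁺ (inQ? m j) {inj₂ i} (sym (toℕ-fromℕ< _))

  not-hypertree : ¬ IntersectionHypertree D
  not-hypertree (T , (_ , _ , _ , _ , acyclic) , connected) =
    no-common (helly m family (λ i → connected (family i) (family-hyperedge i)) family-meet)
    where open Helly _≟ₛ_ T acyclic

-- In D₄ every nontrivial proper subgroup is a vertex, and the hyperedges are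
-- {⟨a⟩ or ⟨a²⟩, ⟨b⟩, ⟨ab⟩, ⟨a²b⟩, ⟨a³b⟩}, {⟨a², b⟩, ⟨ab⟩, ⟨a³b⟩} and {⟨a², ab⟩, ⟨b⟩, ⟨a²b⟩}.
-- Each is a subtree of the tree rooted at ⟨b⟩ given by parentIndex; all of this is checked by
-- evaluation.
module D4 where

  D : FinGroup
  D = Dihedral 4

  open Hypergraph D
  open ≡-Reasoning

  --          e       a       a²      a³      b       ab      a²b     a³b
  subgroups : Vec (Sub D) 8
  subgroups =
      (true  ∷ false ∷ false ∷ false ∷ true  ∷ false ∷ false ∷ false ∷ [])   -- ⟨b⟩
    ∷ (true  ∷ true  ∷ true  ∷ true  ∷ false ∷ false ∷ false ∷ false ∷ [])   -- ⟨a⟩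
    ∷ (true  ∷ false ∷ true  ∷ false ∷ false ∷ false ∷ false ∷ false ∷ [])   -- ⟨a²⟩
    ∷ (true  ∷ false ∷ false ∷ false ∷ false ∷ false ∷ true  ∷ false ∷ [])   -- ⟨a²b⟩
    ∷ (true  ∷ false ∷ false ∷ false ∷ false ∷ false ∷ false ∷ true  ∷ [])   -- ⟨a³b⟩
    ∷ (true  ∷ false ∷ true  ∷ false ∷ false ∷ true  ∷ false ∷ true  ∷ [])   -- ⟨a², ab⟩
    ∷ (true  ∷ false ∷ false ∷ false ∷ false ∷ true  ∷ false ∷ false ∷ [])   -- ⟨ab⟩
    ∷ (true  ∷ false ∷ true  ∷ false ∷ true  ∷ false ∷ true  ∷ false ∷ [])   -- ⟨a², b⟩
    ∷ []

  vertex : Fin 8 → Sub D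
  vertex = lookup subgroups

  parentIndex : Fin 8 → Fin 8
  parentIndex = lookup (zero ∷ zero ∷ zero ∷ zero ∷ zero ∷ # 3 ∷ # 4 ∷ # 6 ∷ [])

  depthIndex : Fin 8 → ℕ
  depthIndex = lookup (0 ∷ 1 ∷ 1 ∷ 1 ∷ 1 ∷ 2 ∷ 2 ∷ 3 ∷ [])

  index : Sub D → Fin 8
  index H with Fin.any? (λ u → H ≟ₛ vertex u)
  ... | yes (u , _) = u
  ... | no  _       = zero

  index-vertex : ∀ u → index (vertex u) ≡ u
  index-vertex = from-yes (Fin.all? λ u → index (vertex u) Fin.≟ u)

  classify : ∀ H → InS D H → ∃ λ u → H ≡ vertex u
  classify H H∈S =
    decidable-stable (Fin.any? λ u → H ≟ₛ vertex u) λ unlisted → no-unlisted (H , H∈S , unlisted)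
    where
    no-unlisted : ¬ ∃ λ H → InS D H × ¬ ∃ λ u → H ≡ vertex u
    no-unlisted = from-no (anySubset? λ H → inS? H ×-dec ¬? (Fin.any? λ u → H ≟ₛ vertex u))

  vertex-InV : ∀ u → InV D (vertex u)
  vertex-InV u = let u∈S , w , w∈S , triv = checked u in u∈S , vertex w , w∈S , triv
    where
    checked : ∀ u → InS D (vertex u) × ∃ λ w → InS D (vertex w) × TrivInt D (vertex u) (vertex w)
    checked = from-yes (Fin.all? λ u → inS? (vertex u)
                         ×-dec Fin.any? λ w → inS? (vertex w) ×-dec trivInt? (vertex u) (vertex w))

  depthIndex-parent : ∀ u → u ≢ zero → depthIndex u ≡ suc (depthIndex (parentIndex u))
  depthIndex-parent =
    from-yes (Fin.all? λ u → ¬? (u Fin.≟ zero) →-dec (depthIndex u ℕ.≟ suc (depthIndex (parentIndex u))))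

  parentIndex-between : ∀ u v w → u ≢ v → depthIndex v ≤ depthIndex u →
                        Compatible (vertex w) (vertex u) → Compatible (vertex w) (vertex v) →
                        Compatible (vertex w) (vertex (parentIndex u))
  parentIndex-between = from-yes (Fin.all? λ u → Fin.all? λ v → Fin.all? λ w →
    ¬? (u Fin.≟ v) →-dec (depthIndex v ℕ.≤? depthIndex u →-dec
      (compatible? (vertex w) (vertex u) →-dec (compatible? (vertex w) (vertex v) →-dec
        compatible? (vertex w) (vertex (parentIndex u))))))

  root : Sub D
  root = vertex zero

  parent : Sub D → Sub D
  parent H = vertex (parentIndex (index H))

  depth : Sub D → ℕ
  depth H = depthIndex (index H)

  ∀-vertex : ∀ (P : Pred (Sub D) 0ℓ) → (∀ u → P (vertex u)) → ∀ {H} → InS D H → P H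
  ∀-vertex P P-vertex {H} H∈S = let u , H≡u = classify H H∈S in subst P (sym H≡u) (P-vertex u)

  depth-vertex : ∀ u → depth (vertex u) ≡ depthIndex u
  depth-vertex u = cong depthIndex (index-vertex u)

  parent-vertex : ∀ u → parent (vertex u) ≡ vertex (parentIndex u)
  parent-vertex u = cong (vertex ∘ parentIndex) (index-vertex u)

  depth-parent-vertex : ∀ u → vertex u ≢ root → depth (vertex u) ≡ suc (depth (parent (vertex u)))
  depth-parent-vertex u u≢root = begin
    depth (vertex u)                     ≡⟨ depth-vertex u ⟩
    depthIndex u                         ≡⟨ depthIndex-parent u (u≢root ∘ cong vertex) ⟩
    suc (depthIndex (parentIndex u))     ≡⟨ cong suc (sym (depth-vertex (parentIndex u))) ⟩
    suc (depth (vertex (parentIndex u))) ≡⟨ cong (suc ∘ depth) (sym (parent-vertex u)) ⟩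
    suc (depth (parent (vertex u)))      ∎

  depth-parent : ∀ {H} → InV D H → H ≢ root → depth H ≡ suc (depth (parent H))
  depth-parent H∈V =
    ∀-vertex (λ H → H ≢ root → depth H ≡ suc (depth (parent H))) depth-parent-vertex (proj₁ H∈V)

  open RootedTree _≟ₛ_ (InV D) root parent depth
                  (λ {H} _ → vertex-InV (parentIndex (index H))) (depth-vertex zero) depth-parent

  parent-absorbed : ∀ {E} → IsHyperedge D E → ∀ {u v} → E (vertex u) → E (vertex v) → u ≢ v →
                    depthIndex v ≤ depthIndex u → E (vertex (parentIndex u))
  parent-absorbed {E} hyp@(E⊆V , _) {u} {v} Eu Ev u≢v dv≤du =
    hyperedge-absorbs hyp (vertex-InV (parentIndex u)) λ L EL → ∀-vertex (λ L → E L → L ≢ p → TrivInt D L p)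
                                                                          triv-vertex (proj₁ (E⊆V EL)) EL
    where
    p = vertex (parentIndex u)
    triv-vertex : ∀ w → E (vertex w) → vertex w ≢ p → TrivInt D (vertex w) p
    triv-vertex w Ew w≢p = fromInj₂ (λ w≡p → contradiction w≡p w≢p)
      (parentIndex-between u v w u≢v dv≤du (hyperedge-compatible hyp Ew Eu) (hyperedge-compatible hyp Ew Ev))

  climb-vertex : ∀ {E} → IsHyperedge D E → ∀ {u v} → E (vertex u) → E (vertex v) → vertex u ≢ vertex v →
                 depth (vertex v) ≤ depth (vertex u) → E (parent (vertex u))
  climb-vertex {E} hyp {u} {v} Eu Ev u≢v dv≤du =
    subst E (sym (parent-vertex u))
      (parent-absorbed hyp {u} {v} Eu Ev (u≢v ∘ cong vertex)
         (subst₂ _≤_ (depth-vertex v) (depth-vertex u) dv≤du))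

  climb : ∀ {E} → IsHyperedge D E → ∀ {H K} → E H → E K → H ≢ K → depth K ≤ depth H → E (parent H)
  climb {E} hyp@(E⊆V , _) {H} {K} EH EK =
    let u , H≡u = classify H (proj₁ (E⊆V EH))
        v , K≡v = classify K (proj₁ (E⊆V EK))
    in subst₂ (λ H K → E H → E K → H ≢ K → depth K ≤ depth H → E (parent H)) (sym H≡u) (sym K≡v)
              (climb-vertex hyp {u} {v}) EH EK

  hypertree : IntersectionHypertree D
  hypertree = Edge , isTree , λ E hyp → connected (proj₁ hyp) (climb hyp)

double-≥3 : ∀ q → 2 < q * 2 → q * 2 ≢ 4 → 3 ≤ q
double-≥3 0                   ()             _
double-≥3 1                   (s≤s (s≤s ())) _
double-≥3 2                   _              q*2≢4 = contradiction refl q*2≢4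
double-≥3 (suc (suc (suc _))) _              _     = s≤s (s≤s (s≤s z≤n))

-- A nonprime n ≥ 2 has a divisor d with 2 ≤ d < n; if d = 2 then n / 2 works unless n = 4.
large-proper-divisor : ∀ {n} → 2 ≤ n → ¬ Prime n → n ≢ 4 → ∃ λ m → m ∣ n × 3 ≤ m × m < n
large-proper-divisor 2≤n ¬prime n≢4 with ¬prime⇒composite {{n>1⇒nonTrivial 2≤n}} ¬prime
... | composite {d} d<n d∣n with nonTrivial⇒n>1 d
...   | s≤s (s≤s (z≤n {suc _})) = d , d∣n , s≤s (s≤s (s≤s z≤n)) , d<n
...   | s≤s (s≤s (z≤n {zero})) with divides q refl ← d∣n =
  q , divides 2 (*-comm q 2) , q≥3 , m<m*n q 2 {{>-nonZero (≤-trans (s≤s z≤n) q≥3)}} (s≤s (s≤s z≤n))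
  where q≥3 = double-≥3 q d<n n≢4

mainTheorem6 : (n : ℕ) .{{_ : NonZero n}} → 2 ≤ n →
    (IntersectionHypertree (Dihedral n) ⇔ (Prime n ⊎ n ≡ 4))
mainTheorem6 n 2≤n = mk⇔ only-if if
  where
  only-if : IntersectionHypertree (Dihedral n) → Prime n ⊎ n ≡ 4
  only-if hypertree with prime? n | n ℕ.≟ 4
  ... | yes n-prime | _       = inj₁ n-prime
  ... | no _        | yes n≡4 = inj₂ n≡4
  ... | no ¬prime | no n≢4 with m , m∣n , 3≤m , m<n ← large-proper-divisor 2≤n ¬prime n≢4 =
    contradiction hypertree (CompositeCase.not-hypertree n 2≤n m m∣n 3≤m m<n)

  if : Prime n ⊎ n ≡ 4 → IntersectionHypertree (Dihedral n)
  if (inj₁ n-prime) = PrimeCase.hypertree n 2≤n n-prime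
  if (inj₂ refl)    = D4.hypertree
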